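{- For every integer $n \geq 2$, there exists a graph $G$ such that both $G$ and $\overline{G}$ are connected and $h(G\overline{G}) = n$.
   Context: All graphs are finite, simple and undirected. For a graph $H$ and $x,y \in V(H)$, the closed interval $I[x,y]$ consists of $x$, $y$ and all vertices lying on some shortest path between $x$ and $y$ in $H$; for $S \subseteq V(H)$, $I[S] = \bigcup_{x,y\in S} I[x,y]$. A set $S$ is (geodetically) convex if $I[S]=S$; the convex hull $H(S)$ is the smallest convex set containing $S$; $S$ is a hull set if $H(S)=V(H)$; the (geodetic) hull number $h(H)$ is the minimum cardinality of a hull set of $H$. For a graph $G$ with vertex set $\{v_1,\dots,v_n\}$, the complementary prism $G\overline{G}$ has vertex set $\{v_1,\dots,v_n\}\cup\{\overline{v}_1,\dots,\overline{v}_n\}$ and edge set $E(G) \cup \{\overline{v}_i\overline{v}_j : i<j,\ v_iv_j\notin E(G)\} \cup \{v_i\overline{v}_i : 1\le i\le n\}$. -}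

module Defs where

open import Data.Nat using (ℕ; zero; suc; _+_; _≤_; _<_)
open import Data.Fin using (Fin; splitAt; _≟_)
open import Data.Fin.Subset using (Subset; _∈_; _⊆_; ∣_∣; ⊤)
open import Data.Bool using (Bool; true; false; not; _∧_)
open import Data.Sum using (_⊎_; inj₁; inj₂)
open import Data.Product using (Σ; ∃; _×_; _,_)
open import Relation.Binary.PropositionalEquality using (_≡_)
open import Relation.Nullary using (¬_)
open import Relation.Nullary.Decidable using (⌊_⌋)

record Graph (n : ℕ) : Set where
  field
    adj   : Fin n → Fin n → Bool
    sym   : ∀ x y → adj x y ≡ adj y x
    irrefl : ∀ x → adj x x ≡ false

open Graph public

Edge : ∀ {n} → Graph n → Fin n → Fin n → Set
Edge G x y = adj G x y ≡ true

data Walk {n : ℕ} (G : Graph n) : Fin n → Fin n → ℕ → Set where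
  nil  : ∀ x → Walk G x x zero
  cons : ∀ {x y z ℓ} → Edge G x y → Walk G y z ℓ → Walk G x z (suc ℓ)

data OnWalk {n : ℕ} {G : Graph n} (v : Fin n) :
       ∀ {x y ℓ} → Walk G x y ℓ → Set where
  here-nil  : OnWalk v (nil v)
  here-cons : ∀ {y z ℓ} (e : Edge G v y) (w : Walk G y z ℓ) → OnWalk v (cons e w)
  there     : ∀ {x y z ℓ} (e : Edge G x y) {w : Walk G y z ℓ} →
              OnWalk v w → OnWalk v (cons e w)

Connected : ∀ {n} → Graph n → Set
Connected G = ∀ x y → ∃ λ ℓ → Walk G x y ℓ

IsDist : ∀ {n} → Graph n → Fin n → Fin n → ℕ → Set
IsDist G x y d = Walk G x y d × (∀ ℓ → Walk G x y ℓ → d ≤ ℓ)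

InInterval : ∀ {n} → Graph n → Fin n → Fin n → Fin n → Set
InInterval G x y z =
  ∃ λ d → IsDist G x y d × Σ (Walk G x y d) (λ w → OnWalk z w)

Convex : ∀ {n} → Graph n → Subset n → Set
Convex G S = ∀ x y z → x ∈ S → y ∈ S → InInterval G x y z → z ∈ S

-- S is a hull set: the smallest convex set containing S is V,
-- i.e. every convex set containing S is all of V.
IsHullSet : ∀ {n} → Graph n → Subset n → Set
IsHullSet G S = ∀ C → S ⊆ C → Convex G C → ∀ v → v ∈ C

HullNumber : ∀ {n} → Graph n → ℕ → Set
HullNumber {n} G k =
  (∃ λ S → IsHullSet G S × ∣ S ∣ ≡ k) ×
  (∀ S → IsHullSet G S → k ≤ ∣ S ∣)

complement : ∀ {n} → Graph n → Graph n
complement G = record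
  { adj    = λ x y → not (adj G x y) ∧ not ⌊ x ≟ y ⌋
  ; sym    = λ x y → symC x y
  ; irrefl = λ x → irrC x
  }
  where
  open import Relation.Binary.PropositionalEquality using (refl; cong₂; cong)
  open import Relation.Nullary using (yes; no)
  symC : ∀ x y → not (adj G x y) ∧ not ⌊ x ≟ y ⌋ ≡ not (adj G y x) ∧ not ⌊ y ≟ x ⌋
  symC x y with x ≟ y | y ≟ x
  ... | yes p | yes q = cong (λ b → not b ∧ false) (Graph.sym G x y)
  ... | no p  | no q  = cong (λ b → not b ∧ true) (Graph.sym G x y)
  ... | yes p | no q  = Data.Empty.⊥-elim (q (Relation.Binary.PropositionalEquality.sym p))
    where import Data.Empty
  ... | no p  | yes q = Data.Empty.⊥-elim (p (Relation.Binary.PropositionalEquality.sym q))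
    where import Data.Empty
  irrC : ∀ x → not (adj G x x) ∧ not ⌊ x ≟ x ⌋ ≡ false
  irrC x with x ≟ x
  ... | yes _ = Data.Bool.Properties.∧-zeroʳ (not (adj G x x))
    where import Data.Bool.Properties
  ... | no ¬p = Data.Empty.⊥-elim (¬p refl)
    where import Data.Empty

-- Complementary prism G Ḡ on vertex set Fin (n + n):
-- the first copy (inj₁ i ~ v_i) carries G, the second (inj₂ i ~ v̄_i) carries Ḡ,
-- and v_i is joined to v̄_i.
prismAdj : ∀ {n} → Graph n → Fin n ⊎ Fin n → Fin n ⊎ Fin n → Bool
prismAdj G (inj₁ a) (inj₁ b) = adj G a b
prismAdj G (inj₂ a) (inj₂ b) = adj (complement G) a b
prismAdj G (inj₁ a) (inj₂ b) = ⌊ a ≟ b ⌋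
prismAdj G (inj₂ a) (inj₁ b) = ⌊ a ≟ b ⌋

complementaryPrism : ∀ {n} → Graph n → Graph (n + n)
complementaryPrism {n} G = record
  { adj    = λ x y → prismAdj G (splitAt n x) (splitAt n y)
  ; sym    = λ x y → pSym (splitAt n x) (splitAt n y)
  ; irrefl = λ x → pIrr (splitAt n x)
  }
  where
  open import Relation.Binary.PropositionalEquality using (refl)
  open import Relation.Nullary using (yes; no)
  import Data.Empty
  import Relation.Binary.PropositionalEquality as P
  pSym : ∀ a b → prismAdj G a b ≡ prismAdj G b a
  pSym (inj₁ a) (inj₁ b) = Graph.sym G a b
  pSym (inj₂ a) (inj₂ b) = Graph.sym (complement G) a b
  pSym (inj₁ a) (inj₂ b) with a ≟ b | b ≟ a
  ... | yes _ | yes _ = refl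
  ... | no _ | no _ = refl
  ... | yes p | no q = Data.Empty.⊥-elim (q (P.sym p))
  ... | no p | yes q = Data.Empty.⊥-elim (p (P.sym q))
  pSym (inj₂ a) (inj₁ b) with a ≟ b | b ≟ a
  ... | yes _ | yes _ = refl
  ... | no _ | no _ = refl
  ... | yes p | no q = Data.Empty.⊥-elim (q (P.sym p))
  ... | no p | yes q = Data.Empty.⊥-elim (p (P.sym q))
  pIrr : ∀ a → prismAdj G a a ≡ false
  pIrr (inj₁ a) = Graph.irrefl G a
  pIrr (inj₂ a) = Graph.irrefl (complement G) a

-- Write k = 2 + j. The graph G has vertices C₀, C₁, P, Q, M 0, …, M (j-1): an edge
-- C₀C₁, a pendant vertex P at C₁, a pendant vertex Q at C₀, and each M i joined to
-- both C₀ and C₁. In the prism GḠ (second-copy vertices written x̄) the set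
-- S₀ = {P, Q, M i} is a hull set: P C₁ C₀ Q and P P̄ Q̄ Q are P–Q geodesics, and the
-- remaining vertices C̄₀, C̄₁, M̄ i are common neighbours of non-adjacent pairs.
--
-- For the lower bound, the k regions {P, C̄₀, P̄}, {Q, C̄₁, Q̄}, {M i, M̄ i} partition
-- all vertices except C₀, C₁, and each has a convex complement. The general criterion
-- behind this (complement-convex) is: if the outer ends of any two edges leaving a set R
-- are at distance ≤ 2 (≤ 1 when the edges share their inner end), no geodesic between
-- two vertices outside R can enter R. A hull set meets every nonempty set with convex
-- complement, hence meets all k disjoint regions and has at least k elements.

module Submission where

open import Defs hiding (sym)
open import Data.Bool.Base using (Bool; true; false; not; _∨_; T)
open import Data.Bool.Properties using (not-injective; ¬-not; ∨-comm) renaming (_≟_ to _≟ᵇ_)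
open import Data.Empty using (⊥-elim)
open import Data.Fin.Base using (Fin; zero; suc; splitAt; join; _↑ˡ_)
open import Data.Fin.Properties using (_≟_; any?; splitAt-join; join-splitAt; injective⇒≤; suc-injective)
open import Data.Fin.Subset using (Subset; _∈_; _⊆_; ∣_∣; ⊤; ⊥; inside; outside)
open import Data.Fin.Subset.Properties using (_∈?_; ∣⊤∣≡n; ∣⊥∣≡0)
open import Data.Maybe.Base using (Maybe; just; nothing)
open import Data.Maybe.Properties using (just-injective) renaming (≡-dec to ≡-decᵐ)
open import Data.Nat.Base using (ℕ; zero; suc; _+_; _≤_; _<_; z≤n; s≤s)
import Data.Nat.Properties as ℕ
open import Data.Nat.Tactic.RingSolver using (solve-∀)
open import Data.Product using (∃; ∃₂; _×_; _,_; proj₁; proj₂)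
open import Data.Sum using (_⊎_; inj₁; inj₂)
open import Data.Unit.Base using (tt)
open import Data.Vec.Base using ([]; _∷_; lookup; tabulate; _++_; here; there)
open import Data.Vec.Properties using (lookup∘tabulate; []=⇒lookup; lookup⇒[]=; lookup-++ˡ; lookup-replicate)
open import Function.Base using (_∘_)
open import Relation.Binary.Definitions using (DecidableEquality)
open import Relation.Binary.PropositionalEquality
open import Relation.Nullary using (¬_; yes; no)
open import Relation.Nullary.Decidable using (⌊_⌋; _×-dec_; isYes≗does; dec-true; dec-false; toWitness)

clash : ∀ {b} {A : Set} → b ≡ true → b ≡ false → A
clash refl ()

module BooleanTest {A : Set} (_≟ᴬ_ : DecidableEquality A) where

  test-complete : ∀ {x y} → x ≡ y → ⌊ x ≟ᴬ y ⌋ ≡ true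
  test-complete {x} {y} x≡y = trans (isYes≗does (x ≟ᴬ y)) (dec-true (x ≟ᴬ y) x≡y)

  test-distinct : ∀ {x y} → x ≢ y → ⌊ x ≟ᴬ y ⌋ ≡ false
  test-distinct {x} {y} x≢y = trans (isYes≗does (x ≟ᴬ y)) (dec-false (x ≟ᴬ y) x≢y)

  test-sound : ∀ {x y} → ⌊ x ≟ᴬ y ⌋ ≡ true → x ≡ y
  test-sound h = toWitness (subst T (sym h) tt)

module FinTest {m : ℕ} = BooleanTest (_≟_ {m})
open FinTest

setOf : ∀ {N} → (Fin N → Bool) → Subset N
setOf = tabulate

∈-setOf⁺ : ∀ {N} {f : Fin N → Bool} {x} → f x ≡ true → x ∈ setOf f
∈-setOf⁺ {f = f} {x} h = lookup⇒[]= x (setOf f) (trans (lookup∘tabulate f x) h)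

∈-setOf⁻ : ∀ {N} {f : Fin N → Bool} {x} → x ∈ setOf f → f x ≡ true
∈-setOf⁻ {f = f} {x} h = trans (sym (lookup∘tabulate f x)) ([]=⇒lookup h)

∉-region : ∀ {N} {ρ : Fin N → Bool} {x} → x ∈ setOf (not ∘ ρ) → ρ x ≡ false
∉-region h = not-injective (∈-setOf⁻ h)

module _ {N : ℕ} {H : Graph N} where

  edge-sym : ∀ {x y} → Edge H x y → Edge H y x
  edge-sym {x} {y} e = trans (Graph.sym H y x) e

  infixr 5 _++ʷ_
  _++ʷ_ : ∀ {x y z a b} → Walk H x y a → Walk H y z b → Walk H x z (a + b)
  nil _    ++ʷ w = w
  cons e v ++ʷ w = cons e (v ++ʷ w)

  reverse : ∀ {x y ℓ} → Walk H x y ℓ → Walk H y x ℓ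
  reverse (nil x) = nil x
  reverse (cons {ℓ = ℓ} e w) =
    subst (Walk H _ _) (ℕ.+-comm ℓ 1) (reverse w ++ʷ cons (edge-sym e) (nil _))

  cut : ∀ {x y z ℓ} (w : Walk H x y ℓ) → OnWalk z w →
        ∃₂ λ a b → Walk H x z a × Walk H z y b × a + b ≡ ℓ
  cut (nil _)    here-nil        = 0 , 0 , nil _ , nil _ , refl
  cut (cons e w) (here-cons _ _) = 0 , _ , nil _ , cons e w , refl
  cut (cons e w) (there _ z∈w) with a , b , front , back , total ← cut w z∈w =
    suc a , b , cons e front , back , cong suc total

  walk₀ : ∀ {x y} → Walk H x y 0 → x ≡ y
  walk₀ (nil _) = refl

  walk₁ : ∀ {x y} → Walk H x y 1 → Edge H x y
  walk₁ (cons e (nil _)) = e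

  walk₂ : ∀ {x y} → Walk H x y 2 → ∃ λ w → Edge H x w × Edge H w y
  walk₂ (cons e (cons e' (nil _))) = _ , e , e'

  record FirstExit (ρ : Fin N → Bool) (z x : Fin N) (ℓ : ℕ) : Set where
    constructor exit
    field
      r e    : Fin N
      t u    : ℕ
      r∈R    : ρ r ≡ true
      e∉R    : ρ e ≡ false
      r–e    : Edge H r e
      before : Walk H z r t
      after  : Walk H e x u
      total  : t + suc u ≡ ℓ

  firstExit : ∀ ρ {z x ℓ} → ρ z ≡ true → ρ x ≡ false → Walk H z x ℓ → FirstExit ρ z x ℓ
  firstExit ρ z∈R x∉R (nil _) = clash z∈R x∉R
  firstExit ρ z∈R x∉R (cons {y = y} e w) with ρ y in ρy
  ... | false = exit _ y 0 _ z∈R ρy e (nil _) w refl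
  ... | true with exit r e' t u r∈R e'∉R r–e' before after total ← firstExit ρ ρy x∉R w =
    exit r e' (suc t) u r∈R e'∉R r–e' (cons e before) after (cong suc total)

connected-via : ∀ {N} {H : Graph N} (c : Fin N) → (∀ x → ∃ λ ℓ → Walk H x c ℓ) → Connected H
connected-via c reach x y with a , x→c ← reach x | b , y→c ← reach y = a + b , x→c ++ʷ reverse y→c

common-neighbour∈I : ∀ {N} (H : Graph N) {x y z} → x ≢ y → adj H x y ≡ false →
                     Edge H x z → Edge H z y → InInterval H x y z
common-neighbour∈I H {x} {y} x≢y x≁y x–z z–y =
  2 , (path , shortest) , path , there x–z (here-cons z–y (nil _))
  where
  path : Walk H x y 2
  path = cons x–z (cons z–y (nil _))
  shortest : ∀ ℓ → Walk H x y ℓ → 2 ≤ ℓ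
  shortest 0 w = ⊥-elim (x≢y (walk₀ w))
  shortest 1 w = clash (walk₁ w) x≁y
  shortest (suc (suc ℓ)) _ = s≤s (s≤s z≤n)

ExitsClose : ∀ {N} → Graph N → (Fin N → Bool) → Set
ExitsClose H ρ = ∀ {r r' e e'} → ρ r ≡ true → ρ r' ≡ true → ρ e ≡ false → ρ e' ≡ false →
  Edge H r e → Edge H r' e' → ∃ λ s → Walk H e e' s × s ≤ 2 × (r ≡ r' → s ≤ 1)

-- The jump between exits is shorter than going through R: t, t' count the steps
-- inside R, and both are 0 only if the two exit edges share their inner end.
jump-shorter : ∀ t t' s → s ≤ 2 → (t ≡ 0 → t' ≡ 0 → s ≤ 1) → s < 2 + (t + t')
jump-shorter zero    zero     s _   s≤1 = s≤s (s≤1 refl refl)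
jump-shorter zero    (suc t') s s≤2 _   = ℕ.≤-trans (s≤s s≤2) (ℕ.m≤m+n 3 t')
jump-shorter (suc t) t'       s s≤2 _   = ℕ.≤-trans (s≤s s≤2) (ℕ.m≤m+n 3 (t + t'))

detour-length : ∀ t t' u u' → (t + suc u) + (t' + suc u') ≡ u + ((2 + (t + t')) + u')
detour-length = solve-∀

-- Two walks from z ∈ R to x, y ∉ R yield a strictly shorter x–y walk: go back from x
-- to the exit of the first walk, jump to the exit of the second, and continue to y.
shortcut : ∀ {N} {H : Graph N} {ρ} → ExitsClose H ρ → ∀ {z x y a b} →
           ρ z ≡ true → ρ x ≡ false → ρ y ≡ false →
           Walk H z x a → Walk H z y b → ∃ λ ℓ → ℓ < a + b × Walk H x y ℓ
shortcut {H = H} {ρ} close {a = a} {b} z∈R x∉R y∉R z→x z→y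
  with exit r e t u r∈R e∉R r–e before after total ← firstExit ρ z∈R x∉R z→x
     | exit r' e' t' u' r'∈R e'∉R r'–e' before' after' total' ← firstExit ρ z∈R y∉R z→y
  with s , jump , s≤2 , sameStart ← close r∈R r'∈R e∉R e'∉R r–e r'–e' =
  u + (s + u') , shorter , reverse after ++ʷ jump ++ʷ after'
  where
  atStart : t ≡ 0 → t' ≡ 0 → s ≤ 1
  atStart t≡0 t'≡0 = sameStart (trans (sym (walk₀ (subst (Walk H _ r) t≡0 before)))
                                      (walk₀ (subst (Walk H _ r') t'≡0 before')))
  shorter : u + (s + u') < a + b
  shorter = subst₂ (λ a b → u + (s + u') < a + b) total total'
    (subst (u + (s + u') <_) (sym (detour-length t t' u u'))
      (ℕ.+-monoʳ-< u (ℕ.+-monoˡ-< u' (jump-shorter t t' s s≤2 atStart))))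

complement-convex : ∀ {N} (H : Graph N) (ρ : Fin N → Bool) → ExitsClose H ρ →
                    Convex H (setOf (not ∘ ρ))
complement-convex H ρ close x y z x∉R y∉R (d , (_ , minimal) , w , z∈w) with ρ z in ρz
... | false = ∈-setOf⁺ (cong not ρz)
... | true with a , b , x→z , z→y , a+b≡d ← cut w z∈w
  with ℓ , ℓ<a+b , x→y ← shortcut close ρz (∉-region x∉R) (∉-region y∉R) (reverse x→z) z→y =
  ⊥-elim (ℕ.<⇒≱ (subst (ℓ <_) a+b≡d ℓ<a+b) (minimal ℓ x→y))

hull-meets : ∀ {N} (H : Graph N) (ρ : Fin N → Bool) {S v} → IsHullSet H S →
             Convex H (setOf (not ∘ ρ)) → ρ v ≡ true → ∃ λ x → x ∈ S × ρ x ≡ true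
hull-meets H ρ {S} {v} hull convex v∈R with any? (λ x → (x ∈? S) ×-dec (ρ x ≟ᵇ true))
... | yes found = found
... | no none = clash v∈R (∉-region (hull (setOf (not ∘ ρ)) S⊆V∖R convex v))
  where
  S⊆V∖R : S ⊆ setOf (not ∘ ρ)
  S⊆V∖R {x} x∈S = ∈-setOf⁺ (cong not (¬-not λ x∈R → none (x , x∈S , x∈R)))

rank : ∀ {N} {S : Subset N} {x} → x ∈ S → Fin ∣ S ∣
rank here = zero
rank (there {y = inside}  x∈S) = suc (rank x∈S)
rank (there {y = outside} x∈S) = rank x∈S

rank-injective : ∀ {N} {S : Subset N} {x y} (p : x ∈ S) (q : y ∈ S) → rank p ≡ rank q → x ≡ y
rank-injective here here _ = refl
rank-injective here (there q) ()
rank-injective (there p) here ()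
rank-injective (there {y = inside}  p) (there q) eq = cong suc (rank-injective p q (suc-injective eq))
rank-injective (there {y = outside} p) (there q) eq = cong suc (rank-injective p q eq)

meets-disjoint⇒≤ : ∀ {N k} (S : Subset N) (R : Fin k → Fin N → Bool) →
  (∀ {r r'} x → R r x ≡ true → R r' x ≡ true → r ≡ r') →
  (∀ r → ∃ λ x → x ∈ S × R r x ≡ true) → k ≤ ∣ S ∣
meets-disjoint⇒≤ S R disjoint meets = injective⇒≤ {f = position} position-injective
  where
  position : _ → Fin ∣ S ∣
  position r = rank (proj₁ (proj₂ (meets r)))
  position-injective : ∀ {r r'} → position r ≡ position r' → r ≡ r'
  position-injective {r} {r'} eq
    with x , x∈S , x∈R ← meets r | x' , x'∈S , x'∈R' ← meets r'
    with refl ← rank-injective x∈S x'∈S eq = disjoint x x∈R x'∈R'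

hull-lower-bound : ∀ {N k} (H : Graph N) (R : Fin k → Fin N → Bool) →
  (∀ {r r'} x → R r x ≡ true → R r' x ≡ true → r ≡ r') →
  (∀ r → ∃ λ v → R r v ≡ true) → (∀ r → Convex H (setOf (not ∘ R r))) →
  ∀ S → IsHullSet H S → k ≤ ∣ S ∣
hull-lower-bound H R disjoint nonempty convex S hull =
  meets-disjoint⇒≤ S R disjoint λ r → hull-meets H (R r) hull (convex r) (proj₂ (nonempty r))

count-++ : ∀ {m k} (xs : Subset m) (ys : Subset k) → ∣ xs ++ ys ∣ ≡ ∣ xs ∣ + ∣ ys ∣
count-++ []           ys = refl
count-++ (true ∷ xs)  ys = cong suc (count-++ xs ys)
count-++ (false ∷ xs) ys = count-++ xs ys

module Construction (j : ℕ) where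

  n : ℕ
  n = 4 + j

  pattern C₀  = zero
  pattern C₁  = suc zero
  pattern P   = suc (suc zero)
  pattern Q   = suc (suc (suc zero))
  pattern M i = suc (suc (suc (suc i)))

  M-injective : ∀ {i i' : Fin j} → _≡_ {A = Fin n} (M i) (M i') → i ≡ i'
  M-injective refl = refl

  link : Fin n → Fin n → Bool
  link C₀ C₁    = true
  link C₀ Q     = true
  link C₀ (M _) = true
  link C₁ P     = true
  link C₁ (M _) = true
  link _  _     = false

  link-irrefl : ∀ x → link x x ≡ false
  link-irrefl C₀    = refl
  link-irrefl C₁    = refl
  link-irrefl P     = refl
  link-irrefl Q     = refl
  link-irrefl (M _) = refl

  G : Graph n
  G = record
    { adj    = λ x y → link x y ∨ link y x
    ; sym    = λ x y → ∨-comm (link x y) (link y x)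
    ; irrefl = λ x → cong (λ b → b ∨ b) (link-irrefl x)
    }

  connected-G : Connected G
  connected-G = connected-via C₀ to-C₀
    where
    to-C₀ : ∀ x → ∃ λ ℓ → Walk G x C₀ ℓ
    to-C₀ C₀    = 0 , nil _
    to-C₀ C₁    = 1 , cons refl (nil _)
    to-C₀ P     = 2 , cons {y = C₁} refl (cons refl (nil _))
    to-C₀ Q     = 1 , cons refl (nil _)
    to-C₀ (M _) = 1 , cons refl (nil _)

  connected-Ḡ : Connected (complement G)
  connected-Ḡ = connected-via P to-P
    where
    to-P : ∀ x → ∃ λ ℓ → Walk (complement G) x P ℓ
    to-P C₀    = 1 , cons refl (nil _)
    to-P C₁    = 2 , cons {y = Q} refl (cons refl (nil _))
    to-P P     = 0 , nil _
    to-P Q     = 1 , cons refl (nil _)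
    to-P (M _) = 1 , cons refl (nil _)

  prism : Graph (n + n)
  prism = complementaryPrism G

  V : Set
  V = Fin n ⊎ Fin n

  PA : V → V → Bool
  PA = prismAdj G

  vtx : V → Fin (n + n)
  vtx = join n n

  coord : Fin (n + n) → V
  coord = splitAt n

  coord-vtx : ∀ a → coord (vtx a) ≡ a
  coord-vtx = splitAt-join n n

  vtx-coord : ∀ x → vtx (coord x) ≡ x
  vtx-coord = join-splitAt n n

  vtx-injective : ∀ {a b} → vtx a ≡ vtx b → a ≡ b
  vtx-injective {a} {b} eq = trans (sym (coord-vtx a)) (trans (cong coord eq) (coord-vtx b))

  adj-vtx : ∀ a b → adj prism (vtx a) (vtx b) ≡ PA a b
  adj-vtx a b = cong₂ PA (coord-vtx a) (coord-vtx b)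

  edge⁺ : ∀ {a b} → PA a b ≡ true → Edge prism (vtx a) (vtx b)
  edge⁺ {a} {b} h = trans (adj-vtx a b) h

  via : ∀ a b {y ℓ} → PA a b ≡ true → Walk prism (vtx b) y ℓ → Walk prism (vtx a) y (suc ℓ)
  via a b h w = cons (edge⁺ {a} {b} h) w

  data Centre : V → Set where
    centre₀ : Centre (inj₁ C₀)
    centre₁ : Centre (inj₁ C₁)

  data Clique : V → Set where
    clique-P : Clique (inj₂ P)
    clique-Q : Clique (inj₂ Q)
    clique-M : ∀ i → Clique (inj₂ (M i))

  centre-close : ∀ {c c'} → Centre c → Centre c' → ∃ λ s → Walk prism (vtx c) (vtx c') s × s ≤ 1
  centre-close centre₀ centre₀ = 0 , nil _ , z≤n
  centre-close centre₀ centre₁ = 1 , via (inj₁ C₀) (inj₁ C₁) refl (nil _) , ℕ.≤-refl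
  centre-close centre₁ centre₀ = 1 , via (inj₁ C₁) (inj₁ C₀) refl (nil _) , ℕ.≤-refl
  centre-close centre₁ centre₁ = 0 , nil _ , z≤n

  clique-close : ∀ {c c'} → Clique c → Clique c' → ∃ λ s → Walk prism (vtx c) (vtx c') s × s ≤ 1
  clique-close clique-P clique-P = 0 , nil _ , z≤n
  clique-close clique-P clique-Q = 1 , via (inj₂ P) (inj₂ Q) refl (nil _) , ℕ.≤-refl
  clique-close clique-P (clique-M i) = 1 , via (inj₂ P) (inj₂ (M i)) refl (nil _) , ℕ.≤-refl
  clique-close clique-Q clique-P = 1 , via (inj₂ Q) (inj₂ P) refl (nil _) , ℕ.≤-refl
  clique-close clique-Q clique-Q = 0 , nil _ , z≤n
  clique-close clique-Q (clique-M i) = 1 , via (inj₂ Q) (inj₂ (M i)) refl (nil _) , ℕ.≤-refl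
  clique-close (clique-M i) clique-P = 1 , via (inj₂ (M i)) (inj₂ P) refl (nil _) , ℕ.≤-refl
  clique-close (clique-M i) clique-Q = 1 , via (inj₂ (M i)) (inj₂ Q) refl (nil _) , ℕ.≤-refl
  clique-close (clique-M i) (clique-M i') with i ≟ i'
  ... | yes refl = 0 , nil _ , z≤n
  ... | no i≢i' = 1 , via (inj₂ (M i)) (inj₂ (M i')) M̄i–M̄i' (nil _) , ℕ.≤-refl
    where
    M̄i–M̄i' : PA (inj₂ (M i)) (inj₂ (M i')) ≡ true
    M̄i–M̄i' = cong not (test-distinct (i≢i' ∘ M-injective))

  centre-to-clique : ∀ {c c'} → Centre c → Clique c' → Walk prism (vtx c) (vtx c') 2
  centre-to-clique centre₀ clique-P = via (inj₁ C₀) (inj₂ C₀) refl (via (inj₂ C₀) (inj₂ P) refl (nil _))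
  centre-to-clique centre₀ clique-Q = via (inj₁ C₀) (inj₁ Q) refl (via (inj₁ Q) (inj₂ Q) refl (nil _))
  centre-to-clique centre₀ (clique-M i) =
    via (inj₁ C₀) (inj₁ (M i)) refl (via (inj₁ (M i)) (inj₂ (M i)) (test-complete refl) (nil _))
  centre-to-clique centre₁ clique-P = via (inj₁ C₁) (inj₁ P) refl (via (inj₁ P) (inj₂ P) refl (nil _))
  centre-to-clique centre₁ clique-Q = via (inj₁ C₁) (inj₂ C₁) refl (via (inj₂ C₁) (inj₂ Q) refl (nil _))
  centre-to-clique centre₁ (clique-M i) =
    via (inj₁ C₁) (inj₁ (M i)) refl (via (inj₁ (M i)) (inj₂ (M i)) (test-complete refl) (nil _))

  region : V → Maybe (Fin (2 + j))
  region (inj₁ C₀)    = nothing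
  region (inj₁ C₁)    = nothing
  region (inj₁ P)     = just zero
  region (inj₁ Q)     = just (suc zero)
  region (inj₁ (M i)) = just (suc (suc i))
  region (inj₂ C₀)    = just zero
  region (inj₂ C₁)    = just (suc zero)
  region (inj₂ P)     = just zero
  region (inj₂ Q)     = just (suc zero)
  region (inj₂ (M i)) = just (suc (suc i))

  _≟ʳ_ : DecidableEquality (Maybe (Fin (2 + j)))
  _≟ʳ_ = ≡-decᵐ _≟_

  open BooleanTest _≟ʳ_ using () renaming
    (test-complete to region-complete; test-sound to region-sound)

  InRegion : Fin (2 + j) → Fin (n + n) → Bool
  InRegion r x = ⌊ region (coord x) ≟ʳ just r ⌋

  regions-disjoint : ∀ {r r'} x → InRegion r x ≡ true → InRegion r' x ≡ true → r ≡ r'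
  regions-disjoint _ x∈R x∈R' = just-injective (trans (sym (region-sound x∈R)) (region-sound x∈R'))

  anchor : Fin (2 + j) → V
  anchor zero          = inj₁ P
  anchor (suc zero)    = inj₁ Q
  anchor (suc (suc i)) = inj₁ (M i)

  regions-nonempty : ∀ r → ∃ λ v → InRegion r v ≡ true
  regions-nonempty r = vtx (anchor r) , region-complete (trans (cong region (coord-vtx (anchor r))) (anchor-in r))
    where
    anchor-in : ∀ r → region (anchor r) ≡ just r
    anchor-in zero          = refl
    anchor-in (suc zero)    = refl
    anchor-in (suc (suc i)) = refl

  data Landing : V → V → Set where
    on-centre : ∀ {a c} → ¬ Clique a → Centre c → Landing a c
    on-clique : ∀ {a c} → Clique a → Clique c → Landing a c

  EdgeKind : V → V → Set
  EdgeKind a c = region a ≡ region c ⊎ Centre a ⊎ Landing a c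

  G-edge : ∀ a c → adj G a c ≡ true → Centre (inj₁ a) ⊎ Centre (inj₁ c)
  G-edge C₀    _     _  = inj₁ centre₀
  G-edge C₁    _     _  = inj₁ centre₁
  G-edge P     C₀    ()
  G-edge P     C₁    _  = inj₂ centre₁
  G-edge P     P     ()
  G-edge P     Q     ()
  G-edge P     (M _) ()
  G-edge Q     C₀    _  = inj₂ centre₀
  G-edge Q     C₁    ()
  G-edge Q     P     ()
  G-edge Q     Q     ()
  G-edge Q     (M _) ()
  G-edge (M _) C₀    _  = inj₂ centre₀
  G-edge (M _) C₁    _  = inj₂ centre₁
  G-edge (M _) P     ()
  G-edge (M _) Q     ()
  G-edge (M _) (M _) ()

  Ḡ-edge : ∀ a c → adj (complement G) a c ≡ true → EdgeKind (inj₂ a) (inj₂ c)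
  Ḡ-edge C₀    C₀     ()
  Ḡ-edge C₀    C₁     ()
  Ḡ-edge C₀    P      _ = inj₁ refl
  Ḡ-edge C₀    Q      ()
  Ḡ-edge C₀    (M _)  ()
  Ḡ-edge C₁    C₀     ()
  Ḡ-edge C₁    C₁     ()
  Ḡ-edge C₁    P      ()
  Ḡ-edge C₁    Q      _ = inj₁ refl
  Ḡ-edge C₁    (M _)  ()
  Ḡ-edge P     C₀     _ = inj₁ refl
  Ḡ-edge P     C₁     ()
  Ḡ-edge P     P      ()
  Ḡ-edge P     Q      _ = inj₂ (inj₂ (on-clique clique-P clique-Q))
  Ḡ-edge P     (M i)  _ = inj₂ (inj₂ (on-clique clique-P (clique-M i)))
  Ḡ-edge Q     C₀     ()
  Ḡ-edge Q     C₁     _ = inj₁ refl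
  Ḡ-edge Q     P      _ = inj₂ (inj₂ (on-clique clique-Q clique-P))
  Ḡ-edge Q     Q      ()
  Ḡ-edge Q     (M i)  _ = inj₂ (inj₂ (on-clique clique-Q (clique-M i)))
  Ḡ-edge (M _) C₀     ()
  Ḡ-edge (M _) C₁     ()
  Ḡ-edge (M i) P      _ = inj₂ (inj₂ (on-clique (clique-M i) clique-P))
  Ḡ-edge (M i) Q      _ = inj₂ (inj₂ (on-clique (clique-M i) clique-Q))
  Ḡ-edge (M i) (M i') _ = inj₂ (inj₂ (on-clique (clique-M i) (clique-M i')))

  rung-down : ∀ a → EdgeKind (inj₁ a) (inj₂ a)
  rung-down C₀    = inj₂ (inj₁ centre₀)
  rung-down C₁    = inj₂ (inj₁ centre₁)
  rung-down P     = inj₁ refl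
  rung-down Q     = inj₁ refl
  rung-down (M _) = inj₁ refl

  rung-up : ∀ a → EdgeKind (inj₂ a) (inj₁ a)
  rung-up C₀    = inj₂ (inj₂ (on-centre (λ ()) centre₀))
  rung-up C₁    = inj₂ (inj₂ (on-centre (λ ()) centre₁))
  rung-up P     = inj₁ refl
  rung-up Q     = inj₁ refl
  rung-up (M _) = inj₁ refl

  edge-kind : ∀ a c → PA a c ≡ true → EdgeKind a c
  edge-kind (inj₁ a) (inj₁ c) h with G-edge a c h
  ... | inj₁ a∈centre = inj₂ (inj₁ a∈centre)
  ... | inj₂ c∈centre = inj₂ (inj₂ (on-centre (λ ()) c∈centre))
  edge-kind (inj₁ a) (inj₂ c) h with refl ← test-sound h = rung-down a
  edge-kind (inj₂ a) (inj₁ c) h with refl ← test-sound h = rung-up a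
  edge-kind (inj₂ a) (inj₂ c) h = Ḡ-edge a c h

  centre-unassigned : ∀ {c r} → Centre c → region c ≢ just r
  centre-unassigned centre₀ ()
  centre-unassigned centre₁ ()

  leaving : ∀ {r a c} → region a ≡ just r → region c ≢ just r → PA a c ≡ true → Landing a c
  leaving {a = a} {c} a∈R c∉R h with edge-kind a c h
  ... | inj₁ same               = ⊥-elim (c∉R (trans (sym same) a∈R))
  ... | inj₂ (inj₁ a∈centre)    = ⊥-elim (centre-unassigned a∈centre a∈R)
  ... | inj₂ (inj₂ landing)     = landing

  landings-close : ∀ {a a' c c'} → Landing a c → Landing a' c' →
    ∃ λ s → Walk prism (vtx c) (vtx c') s × s ≤ 2 × (a ≡ a' → s ≤ 1)
  landings-close (on-centre _ c) (on-centre _ c') with s , w , s≤1 ← centre-close c c' =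
    s , w , ℕ.m≤n⇒m≤1+n s≤1 , λ _ → s≤1
  landings-close (on-clique _ c) (on-clique _ c') with s , w , s≤1 ← clique-close c c' =
    s , w , ℕ.m≤n⇒m≤1+n s≤1 , λ _ → s≤1
  landings-close (on-centre a∉K c) (on-clique a'∈K c') =
    2 , centre-to-clique c c' , ℕ.≤-refl , λ { refl → ⊥-elim (a∉K a'∈K) }
  landings-close (on-clique a∈K c) (on-centre a'∉K c') =
    2 , reverse (centre-to-clique c' c) , ℕ.≤-refl , λ { refl → ⊥-elim (a'∉K a∈K) }

  region≢ : ∀ {r y} → InRegion r y ≡ false → region (coord y) ≢ just r
  region≢ y∉R y∈R = clash (region-complete y∈R) y∉R

  regions-exits-close : ∀ r → ExitsClose prism (InRegion r)
  regions-exits-close r {x} {x'} {e} {e'} x∈R x'∈R e∉R e'∉R x–e x'–e'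
    with s , w , s≤2 , sameStart ←
      landings-close (leaving (region-sound x∈R) (region≢ {y = e} e∉R) x–e)
                     (leaving (region-sound x'∈R) (region≢ {y = e'} e'∉R) x'–e') =
    s , subst₂ (λ u v → Walk prism u v s) (vtx-coord e) (vtx-coord e') w , s≤2 , sameStart ∘ cong coord

  every-hull-set-is-large : ∀ S → IsHullSet prism S → 2 + j ≤ ∣ S ∣
  every-hull-set-is-large = hull-lower-bound prism InRegion regions-disjoint regions-nonempty
    (λ r → complement-convex prism (InRegion r) (regions-exits-close r))

  -- P and Q have no common neighbour, so they are at distance 3.
  P-Q-apart : ∀ c → PA (inj₁ P) c ≡ true → ¬ PA c (inj₁ Q) ≡ true
  P-Q-apart (inj₁ C₀)    ()
  P-Q-apart (inj₁ C₁)    _ ()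
  P-Q-apart (inj₁ P)     ()
  P-Q-apart (inj₁ Q)     ()
  P-Q-apart (inj₁ (M _)) ()
  P-Q-apart (inj₂ C₀)    ()
  P-Q-apart (inj₂ C₁)    ()
  P-Q-apart (inj₂ P)     _ ()
  P-Q-apart (inj₂ Q)     ()
  P-Q-apart (inj₂ (M _)) ()

  vP vQ : Fin (n + n)
  vP = vtx (inj₁ P)
  vQ = vtx (inj₁ Q)

  P-Q-distance : ∀ ℓ → Walk prism vP vQ ℓ → 3 ≤ ℓ
  P-Q-distance 0 w with () ← vtx-injective {inj₁ P} {inj₁ Q} (walk₀ w)
  P-Q-distance 1 w = clash (walk₁ w) refl
  P-Q-distance 2 w with c , P–c , c–Q ← walk₂ w = ⊥-elim (P-Q-apart (coord c) P–c c–Q)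
  P-Q-distance (suc (suc (suc ℓ))) _ = s≤s (s≤s (s≤s z≤n))

  geodesic-centre geodesic-clique : Walk prism vP vQ 3
  geodesic-centre = via (inj₁ P) (inj₁ C₁) refl (via (inj₁ C₁) (inj₁ C₀) refl (via (inj₁ C₀) (inj₁ Q) refl (nil _)))
  geodesic-clique = via (inj₁ P) (inj₂ P) refl (via (inj₂ P) (inj₂ Q) refl (via (inj₂ Q) (inj₁ Q) refl (nil _)))

  on-P-Q-geodesic : ∀ {z} (w : Walk prism vP vQ 3) → OnWalk z w → InInterval prism vP vQ z
  on-P-Q-geodesic w z∈w = 3 , (w , P-Q-distance) , w , z∈w

  between : ∀ a b c → a ≢ b → PA a b ≡ false → PA a c ≡ true → PA c b ≡ true →
            InInterval prism (vtx a) (vtx b) (vtx c)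
  between a b c a≢b a≁b a–c c–b = common-neighbour∈I prism (a≢b ∘ vtx-injective)
    (trans (adj-vtx a b) a≁b) (edge⁺ {a} {c} a–c) (edge⁺ {c} {b} c–b)

  hull-vertices : Subset n
  hull-vertices = outside ∷ outside ∷ inside ∷ inside ∷ ⊤

  S₀ : Subset (n + n)
  S₀ = hull-vertices ++ ⊥

  ∣S₀∣ : ∣ S₀ ∣ ≡ 2 + j
  ∣S₀∣ = begin
    ∣ S₀ ∣                     ≡⟨ count-++ hull-vertices ⊥ ⟩
    2 + ∣ ⊤ {j} ∣ + ∣ ⊥ {n} ∣  ≡⟨ cong₂ (λ a b → 2 + a + b) (∣⊤∣≡n j) (∣⊥∣≡0 n) ⟩
    2 + j + 0                  ≡⟨ ℕ.+-identityʳ (2 + j) ⟩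
    2 + j                      ∎
    where open ≡-Reasoning

  ∈S₀ : ∀ a → lookup hull-vertices a ≡ true → vtx (inj₁ a) ∈ S₀
  ∈S₀ a h = lookup⇒[]= (a ↑ˡ n) S₀ (trans (lookup-++ˡ hull-vertices ⊥ a) h)

  S₀-hull : IsHullSet prism S₀
  S₀-hull C S₀⊆C convex x = subst (_∈ C) (vtx-coord x) (everything (coord x))
    where
    closed : ∀ {x y z} → x ∈ C → y ∈ C → InInterval prism x y z → z ∈ C
    closed = convex _ _ _
    P∈C : vP ∈ C
    P∈C = S₀⊆C (∈S₀ P refl)
    Q∈C : vQ ∈ C
    Q∈C = S₀⊆C (∈S₀ Q refl)
    M∈C : ∀ i → vtx (inj₁ (M i)) ∈ C
    M∈C i = S₀⊆C (∈S₀ (M i) (lookup-replicate i inside))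
    C₁∈C : vtx (inj₁ C₁) ∈ C
    C₁∈C = closed P∈C Q∈C (on-P-Q-geodesic geodesic-centre (there _ (here-cons _ _)))
    C₀∈C : vtx (inj₁ C₀) ∈ C
    C₀∈C = closed P∈C Q∈C (on-P-Q-geodesic geodesic-centre (there _ (there _ (here-cons _ _))))
    P̄∈C : vtx (inj₂ P) ∈ C
    P̄∈C = closed P∈C Q∈C (on-P-Q-geodesic geodesic-clique (there _ (here-cons _ _)))
    Q̄∈C : vtx (inj₂ Q) ∈ C
    Q̄∈C = closed P∈C Q∈C (on-P-Q-geodesic geodesic-clique (there _ (there _ (here-cons _ _))))
    everything : ∀ a → vtx a ∈ C
    everything (inj₁ C₀)    = C₀∈C
    everything (inj₁ C₁)    = C₁∈C
    everything (inj₁ P)     = P∈C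
    everything (inj₁ Q)     = Q∈C
    everything (inj₁ (M i)) = M∈C i
    everything (inj₂ C₀)    = closed C₀∈C P̄∈C (between (inj₁ C₀) (inj₂ P) (inj₂ C₀) (λ ()) refl refl refl)
    everything (inj₂ C₁)    = closed C₁∈C Q̄∈C (between (inj₁ C₁) (inj₂ Q) (inj₂ C₁) (λ ()) refl refl refl)
    everything (inj₂ P)     = P̄∈C
    everything (inj₂ Q)     = Q̄∈C
    everything (inj₂ (M i)) =
      closed (M∈C i) P̄∈C (between (inj₁ (M i)) (inj₂ P) (inj₂ (M i)) (λ ()) refl (test-complete refl) refl)

theorem8 : ∀ (k : ℕ) → 2 ≤ k →
    ∃ λ n → ∃ λ (G : Graph n) →
      Connected G × Connected (complement G) × HullNumber (complementaryPrism G) k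
theorem8 (suc (suc j)) (s≤s (s≤s z≤n)) =
  n , G , connected-G , connected-Ḡ , (S₀ , S₀-hull , ∣S₀∣) , every-hull-set-is-large
  where open Construction j
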